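{- Let $G$ be a graph with nonnegative real edge weights ${\bf w}$ and $\Delta=\Delta(G,{\bf w})$. For all $X,Y\subseteq V(G)$ with $Y\neq\emptyset$, $$\sum_{m=0}^\infty\Delta^{ -m}f_m(X,Y)\le1.$$
   Context: Graphs are finite, undirected and loopless; multiple edges allowed. $d_G(x,{\bf w})=\sum_{e\ni x}w_e$, $\Delta(G,{\bf w})=\max_xd_G(x,{\bf w})$. A subgraph $H$ is determined by its vertex set $V(H)$ and edge set $E(H)$ (isolated vertices allowed); its weight is $w(H)=\prod_{e\in E(H)}w_e$ ($=1$ if $E(H)=\emptyset$). For a forest $F$, $L(F)$ is the set of vertices of degree 0 or 1 in $F$. ${\mathcal F}_m(X,Y)$ is the set of all forests $F$ in $G$ with $|E(F)|=m$ such that $L(F)\subseteq X\cup Y\subseteq V(F)$ and each component of $F$ contains exactly one vertex of $Y$; $f_m(X,Y)=\sum_{F\in{\mathcal F}_m(X,Y)}w(F)$. -}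

module Defs where

open import Level using (Level; _⊔_) renaming (suc to lsuc)
open import Data.Nat as ℕ using (ℕ; zero; suc)
open import Data.Fin as Fin using (Fin; zero; suc; inject₁; fromℕ; _≟_)
open import Data.Fin.Subset as Sub using (Subset; _∪_; _⊆_; ∣_∣; Nonempty)
open import Data.Bool using (Bool; true; false; if_then_else_; _∨_; _∧_)
open import Data.Vec using (lookup)
open import Data.Product using (Σ; ∃; ∃-syntax; _×_; _,_; proj₁; proj₂)
open import Data.Sum using (_⊎_)
open import Data.List using (List; []; _∷_)
open import Data.List.Relation.Unary.Unique.Propositional using (Unique)
import Data.List.Membership.Propositional as LMem
open import Relation.Nullary using (¬_; does)
open import Relation.Binary using (Rel; IsTotalOrder)
open import Relation.Binary.PropositionalEquality using (_≡_; _≢_)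
open import Relation.Binary.Construct.Closure.ReflexiveTransitive using (Star)
open import Function.Definitions using (Injective)
open import Algebra.Bundles using (CommutativeRing)

-- Ordered fields (the stdlib has none).  The real numbers are an
-- instance.  The inverse is total with the convention 0⁻¹ = 0.

record OrderedField (c ℓ : Level) : Set (lsuc (c ⊔ ℓ)) where
  field
    commutativeRing : CommutativeRing c ℓ
  open CommutativeRing commutativeRing public
  infix 4 _≤_
  infix 8 _⁻¹
  field
    _≤_          : Rel Carrier ℓ
    isTotalOrder : IsTotalOrder _≈_ _≤_
    +-mono-≤     : ∀ {x y} z → x ≤ y → x + z ≤ y + z
    *-nonneg     : ∀ {x y} → 0# ≤ x → 0# ≤ y → 0# ≤ x * y
    0≉1          : ¬ (0# ≈ 1#)
    _⁻¹          : Carrier → Carrier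
    ⁻¹-inverse   : ∀ x → ¬ (x ≈ 0#) → x * x ⁻¹ ≈ 1#
    0⁻¹≈0        : 0# ⁻¹ ≈ 0#

-- Graphs: vertex set Fin n, edge set Fin k, each edge has two distinct
-- ends (loopless; parallel edges allowed).

record Graph : Set where
  field
    n        : ℕ
    k        : ℕ
    ends     : Fin k → Fin n × Fin n
    loopless : ∀ e → proj₁ (ends e) ≢ proj₂ (ends e)
open Graph public

Joins : (G : Graph) → Fin (k G) → Fin (n G) → Fin (n G) → Set
Joins G e u v = ends G e ≡ (u , v) ⊎ ends G e ≡ (v , u)

incident : (G : Graph) → Fin (n G) → Fin (k G) → Bool
incident G x e = does (x ≟ proj₁ (ends G e)) ∨ does (x ≟ proj₂ (ends G e))

SubG : Graph → Set
SubG G = Subset (n G) × Subset (k G)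

sumℕ : (m : ℕ) → (Fin m → ℕ) → ℕ
sumℕ zero    f = 0
sumℕ (suc m) f = f zero ℕ.+ sumℕ m (λ i → f (suc i))

module _ (G : Graph) where

  IsSubgraph : SubG G → Set
  IsSubgraph (V , E) =
    ∀ e → e Sub.∈ E → proj₁ (ends G e) Sub.∈ V × proj₂ (ends G e) Sub.∈ V

  degE : Subset (k G) → Fin (n G) → ℕ
  degE E x = sumℕ (k G) (λ e → if incident G x e ∧ lookup E e then 1 else 0)

  Leaves : SubG G → Fin (n G) → Set
  Leaves (V , E) x = x Sub.∈ V × degE E x ℕ.≤ 1

  record Cycle (E : Subset (k G)) : Set where
    field
      l        : ℕ
      l≥1      : 1 ℕ.≤ l
      es       : Fin l → Fin (k G)
      vs       : Fin (suc l) → Fin (n G)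
      es-inj   : Injective _≡_ _≡_ es
      vs-inj   : Injective _≡_ _≡_ (λ i → vs (inject₁ i))
      closed   : vs (fromℕ l) ≡ vs zero
      es∈E     : ∀ i → es i Sub.∈ E
      es-joins : ∀ i → Joins G (es i) (vs (inject₁ i)) (vs (suc i))

  IsForest : SubG G → Set
  IsForest (V , E) = IsSubgraph (V , E) × ¬ Cycle E

  AdjIn : Subset (k G) → Fin (n G) → Fin (n G) → Set
  AdjIn E u v = ∃[ e ] (e Sub.∈ E × Joins G e u v)

  Connected : Subset (k G) → Fin (n G) → Fin (n G) → Set
  Connected E = Star (AdjIn E)

  InFam : ℕ → Subset (n G) → Subset (n G) → SubG G → Set
  InFam m X Y (V , E) =
    IsForest (V , E) ×
    ∣ E ∣ ≡ m ×
    (∀ x → Leaves (V , E) x → x Sub.∈ X ∪ Y) ×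
    (X ∪ Y ⊆ V) ×
    (∀ v → v Sub.∈ V →
       (∃[ y ] (y Sub.∈ Y × Connected E v y)) ×
       (∀ y y′ → y Sub.∈ Y → y′ Sub.∈ Y →
          Connected E v y → Connected E v y′ → y ≡ y′))

record Enumerates {A : Set} (P : A → Set) (L : List A) : Set where
  field
    unique   : Unique L
    complete : ∀ a → P a → a LMem.∈ L
    sound    : ∀ a → a LMem.∈ L → P a

module _ {c ℓ} (K : OrderedField c ℓ) where
  open OrderedField K using (Carrier; _≈_; _≤_; _+_; _*_; 0#; 1#)

  sumK : (m : ℕ) → (Fin m → Carrier) → Carrier
  sumK zero    f = 0#
  sumK (suc m) f = f zero + sumK m (λ i → f (suc i))

  prodK : (m : ℕ) → (Fin m → Carrier) → Carrier
  prodK zero    f = 1#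
  prodK (suc m) f = f zero * prodK m (λ i → f (suc i))

  powK : Carrier → ℕ → Carrier
  powK x zero    = 1#
  powK x (suc m) = x * powK x m

  sumList : {A : Set} → (A → Carrier) → List A → Carrier
  sumList f []       = 0#
  sumList f (a ∷ as) = f a + sumList f as

  module _ (G : Graph) (w : Fin (k G) → Carrier) where

    degW : Fin (n G) → Carrier
    degW x = sumK (k G) (λ e → if incident G x e then w e else 0#)

    IsMaxDeg : Carrier → Set ℓ
    IsMaxDeg Δ = (∀ x → degW x ≤ Δ) × (∃[ x ] (degW x ≈ Δ))

    weight : SubG G → Carrier
    weight (V , E) = prodK (k G) (λ e → if lookup E e then w e else 1#)

    -- f_m(X,Y), computed from an enumeration L of 𝓕_m(X,Y)
    fSum : List (SubG G) → Carrier
    fSum L = sumList weight L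

-- Induction on the number of vertices outside Y.  If X ⊆ Y, a vertex of a forest
-- F ∈ 𝓕_m(X,Y) outside Y cannot be a leaf, so a path from it to the root of its
-- component could be extended forever; hence F = (Y, ∅) and the series is at most 1.
-- Otherwise fix x ∈ X ∖ Y.  Deleting from F ∈ 𝓕_{m+1}(X,Y) the first edge e = xu of the
-- path from x to its root gives F − e ∈ 𝓕_m(X ∪ {u}, Y ∪ {x}), and F ↦ (e, F − e) is
-- injective, so f_{m+1}(X,Y) ≤ Σ_{e ∋ x} w_e f_m(X ∪ {u}, Y ∪ {x}).  By induction every
-- series on the right is at most 1, and Σ_{e ∋ x} w_e / Δ = d(x) / Δ ≤ 1.

module Submission where

open import Defs
open import Data.Nat as ℕ using (ℕ; zero; suc; _<_; s≤s; z≤n)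
import Data.Nat.Properties as ℕP
open import Data.Fin using (Fin; zero; suc; inject₁; fromℕ; toℕ; _≟_)
open import Data.Fin.Properties
  using (any?; suc-injective; inject₁-injective; fromℕ≢inject₁; toℕ-inject₁; injective⇒≤)
open import Data.Fin.Subset
  using (Subset; inside; outside; _∈_; _∉_; _⊆_; _∪_; _-_; ⁅_⁆; ⊥; Empty; Nonempty; ∣_∣)
open import Data.Fin.Subset.Properties
  using ( _∈?_; p─⊥≡p; p─q⊆p; x∈p∧x≢y⇒x∈p-y; ⊆-antisym; x∈p∪q⁺; x∈p∪q⁻; x∈⁅x⁆; x∈⁅y⁆⇒x≡y
        ; p⊆p∪q; p⊂q⇒∣p∣<∣q∣; Empty-unique; ∣⊥∣≡0; ∣p∣≤n)
open import Data.Bool using (true; false; if_then_else_; _∧_; T)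
open import Data.Bool.Properties using (T?)
open import Data.Vec using ([]; _∷_; lookup; here; there)
open import Data.Vec.Properties using ([]=⇒lookup; lookup⇒[]=; lookup-replicate)
open import Data.Product using (Σ; ∃-syntax; _×_; _,_; proj₁; proj₂)
open import Data.Sum using (_⊎_; inj₁; inj₂; [_,_]′)
open import Data.List using (List; []; _∷_; map)
open import Data.List.Membership.Propositional using () renaming (_∈_ to _∈ₗ_; _∉_ to _∉ₗ_)
import Data.List.Membership.DecPropositional as DecMembership
open import Data.List.Relation.Unary.Any using (here; there)
open import Data.List.Relation.Unary.All as All using (All; []; _∷_)
open import Data.List.Relation.Unary.All.Properties using (¬Any⇒All¬; All¬⇒¬Any; map⁻)
open import Data.List.Relation.Unary.AllPairs using ([]; _∷_)
open import Data.List.Relation.Unary.Unique.Propositional using (Unique)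
open import Function using (_∘_)
open import Relation.Nullary using (¬_; yes; no; does; contradiction; ¬?; _×-dec_)
open import Relation.Nullary.Decidable using (decidable-stable)
open import Relation.Binary.PropositionalEquality
  using (_≡_; _≢_; refl; sym; trans; cong; cong₂; subst)
open import Relation.Binary.Bundles using (Poset)
open import Relation.Binary.Structures using (IsTotalOrder)
open import Relation.Binary.Construct.Closure.ReflexiveTransitive as Star using (ε; _◅_; _◅◅_)
import Algebra.Properties.Ring as RingProperties
import Algebra.Properties.AbelianGroup as AbelianGroupProperties
import Algebra.Properties.CommutativeSemigroup as CommutativeSemigroupProperties

private variable
  m : ℕ

-- Finite subsets

p-x[x]≡outside : ∀ (p : Subset m) x → lookup (p - x) x ≡ outside
p-x[x]≡outside (s ∷ p) zero    = refl
p-x[x]≡outside (s ∷ p) (suc x) = p-x[x]≡outside p x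

p-x[y]≡p[y] : ∀ (p : Subset m) {x y} → y ≢ x → lookup (p - x) y ≡ lookup p y
p-x[y]≡p[y] (s ∷ p) {zero}  {zero}  y≢x = contradiction refl y≢x
p-x[y]≡p[y] (s ∷ p) {zero}  {suc y} y≢x = cong (λ q → lookup q y) (p─⊥≡p p)
p-x[y]≡p[y] (s ∷ p) {suc x} {zero}  y≢x = refl
p-x[y]≡p[y] (s ∷ p) {suc x} {suc y} y≢x = p-x[y]≡p[y] p (y≢x ∘ cong suc)

x∉p-x : ∀ {p : Subset m} {x} → x ∉ p - x
x∉p-x {p = p} {x} x∈p-x with trans (sym ([]=⇒lookup x∈p-x)) (p-x[x]≡outside p x)
... | ()

x∈p-y⇒x∈p : ∀ {p : Subset m} {x y} → x ∈ p - y → x ∈ p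
x∈p-y⇒x∈p {p = p} {y = y} = p─q⊆p p ⁅ y ⁆

x∈p-y⇒x≢y : ∀ {p : Subset m} {x y} → x ∈ p - y → x ≢ y
x∈p-y⇒x≢y x∈p-y refl = x∉p-x x∈p-y

x∈p⇒∣p∣≡1+∣p-x∣ : ∀ {p : Subset m} {x} → x ∈ p → ∣ p ∣ ≡ suc ∣ p - x ∣
x∈p⇒∣p∣≡1+∣p-x∣ {p = inside ∷ p}  here      = cong suc (sym (cong ∣_∣ (p─⊥≡p p)))
x∈p⇒∣p∣≡1+∣p-x∣ {p = inside ∷ p}  (there m) = cong suc (x∈p⇒∣p∣≡1+∣p-x∣ m)
x∈p⇒∣p∣≡1+∣p-x∣ {p = outside ∷ p} (there m) = x∈p⇒∣p∣≡1+∣p-x∣ m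

x∈p∪⁅x⁆ : ∀ {p : Subset m} {x} → x ∈ p ∪ ⁅ x ⁆
x∈p∪⁅x⁆ {x = x} = x∈p∪q⁺ (inj₂ (x∈⁅x⁆ x))

y∈p∪⁅x⁆⁻ : ∀ {p : Subset m} {x y} → y ∈ p ∪ ⁅ x ⁆ → y ≡ x ⊎ y ∈ p
y∈p∪⁅x⁆⁻ {p = p} {x} y∈ with x∈p∪q⁻ p ⁅ x ⁆ y∈
... | inj₁ y∈p = inj₂ y∈p
... | inj₂ y∈x = inj₁ (x∈⁅y⁆⇒x≡y x y∈x)

x∉p⇒∣p∣<∣p∪⁅x⁆∣ : ∀ {p : Subset m} {x} → x ∉ p → ∣ p ∣ < ∣ p ∪ ⁅ x ⁆ ∣
x∉p⇒∣p∣<∣p∪⁅x⁆∣ {p = p} {x} x∉p = p⊂q⇒∣p∣<∣q∣ (p⊆p∪q ⁅ x ⁆ , x , x∈p∪⁅x⁆ , x∉p)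

p-x≡q-x⇒p≡q : ∀ {p q : Subset m} {x} → x ∈ p → x ∈ q → p - x ≡ q - x → p ≡ q
p-x≡q-x⇒p≡q {p = p} {q} {x} x∈p x∈q p-x≡q-x = ⊆-antisym (⊆ x∈q p-x≡q-x) (⊆ x∈p (sym p-x≡q-x))
  where
  ⊆ : ∀ {r s} → x ∈ s → r - x ≡ s - x → r ⊆ s
  ⊆ x∈s r-x≡s-x {y} y∈r with y ≟ x
  ... | yes refl = x∈s
  ... | no  y≢x  = x∈p-y⇒x∈p (subst (y ∈_) r-x≡s-x (x∈p∧x≢y⇒x∈p-y y∈r y≢x))

⊆-or-∉ : ∀ (p q : Subset m) → p ⊆ q ⊎ ∃[ x ] (x ∈ p × x ∉ q)
⊆-or-∉ p q with any? (λ x → (x ∈? p) ×-dec ¬? (x ∈? q))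
... | yes witness = inj₂ witness
... | no  none    = inj₁ λ {x} x∈p → decidable-stable (x ∈? q) (λ x∉q → none (x , x∈p , x∉q))

-- Finite sums

module OrderedFieldProperties {c ℓ} (K : OrderedField c ℓ) where

  open OrderedField K hiding (zero; _-_)
    renaming (+-mono-≤ to +-monoˡ-≤; refl to ≈-refl; sym to ≈-sym; trans to ≈-trans)
  open IsTotalOrder isTotalOrder public
    using (total; antisym) renaming (refl to ≤-refl; trans to ≤-trans; reflexive to ≤-reflexive)
  open RingProperties ring using (x[y-z]≈xy-xz; -1*x≈-x)
  open AbelianGroupProperties +-abelianGroup using (⁻¹-involutive)
  open CommutativeSemigroupProperties +-commutativeSemigroup using (interchange)
  open import Relation.Binary.Reasoning.Setoid setoid

  poset : Poset c ℓ ℓ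
  poset = record { isPartialOrder = IsTotalOrder.isPartialOrder isTotalOrder }

  ≤-respˡ-≈ : ∀ {x y z} → x ≈ y → y ≤ z → x ≤ z
  ≤-respˡ-≈ x≈y y≤z = ≤-trans (≤-reflexive x≈y) y≤z

  ≤-respʳ-≈ : ∀ {x y z} → x ≤ y → y ≈ z → x ≤ z
  ≤-respʳ-≈ x≤y y≈z = ≤-trans x≤y (≤-reflexive y≈z)

  +-mono-≤ : ∀ {x y u v} → x ≤ y → u ≤ v → x + u ≤ y + v
  +-mono-≤ {x} {y} {u} {v} x≤y u≤v =
    ≤-trans (+-monoˡ-≤ u x≤y)
            (≤-respˡ-≈ (+-comm y u) (≤-respʳ-≈ (+-monoˡ-≤ y u≤v) (+-comm v y)))

  0≤y-x⇒x≤y : ∀ {x y} → 0# ≤ y + - x → x ≤ y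
  0≤y-x⇒x≤y {x} {y} 0≤y-x = ≤-respˡ-≈ (≈-sym (+-identityˡ x)) (≤-respʳ-≈ (+-monoˡ-≤ x 0≤y-x) y-x+x≈y)
    where
    y-x+x≈y : (y + - x) + x ≈ y
    y-x+x≈y = begin
      (y + - x) + x ≈⟨ +-assoc y (- x) x ⟩
      y + (- x + x) ≈⟨ +-congˡ (-‿inverseˡ x) ⟩
      y + 0#        ≈⟨ +-identityʳ y ⟩
      y             ∎

  x≤y⇒0≤y-x : ∀ {x y} → x ≤ y → 0# ≤ y + - x
  x≤y⇒0≤y-x {x} x≤y = ≤-respˡ-≈ (≈-sym (-‿inverseʳ x)) (+-monoˡ-≤ (- x) x≤y)

  *-monoˡ-≤ : ∀ {z x y} → 0# ≤ z → x ≤ y → z * x ≤ z * y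
  *-monoˡ-≤ {z} {x} {y} 0≤z x≤y =
    0≤y-x⇒x≤y (≤-respʳ-≈ (*-nonneg 0≤z (x≤y⇒0≤y-x x≤y)) (x[y-z]≈xy-xz z y x))

  0≤1 : 0# ≤ 1#
  0≤1 with total 0# 1#
  ... | inj₁ 0≤1 = 0≤1
  ... | inj₂ 1≤0 = ≤-respʳ-≈ (*-nonneg 0≤-1 0≤-1) -1*-1≈1
    where
    0≤-1 : 0# ≤ - 1#
    0≤-1 = ≤-respˡ-≈ (≈-sym (-‿inverseʳ 1#)) (≤-respʳ-≈ (+-monoˡ-≤ (- 1#) 1≤0) (+-identityˡ (- 1#)))
    -1*-1≈1 : - 1# * - 1# ≈ 1#
    -1*-1≈1 = ≈-trans (-1*x≈-x (- 1#)) (⁻¹-involutive 1#)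

  1≰0 : ¬ (1# ≤ 0#)
  1≰0 1≤0 = 0≉1 (antisym 0≤1 1≤0)

  x⁻¹*x≤1 : ∀ x → x ⁻¹ * x ≤ 1#
  x⁻¹*x≤1 x with total (x ⁻¹ * x) 1#
  ... | inj₁ x⁻¹x≤1 = x⁻¹x≤1
  ... | inj₂ 1≤x⁻¹x = ≤-reflexive (≈-trans (*-comm (x ⁻¹) x) (⁻¹-inverse x x≉0))
    where
    x≉0 : ¬ (x ≈ 0#)
    x≉0 x≈0 = 1≰0 (≤-respʳ-≈ 1≤x⁻¹x (≈-trans (*-congˡ x≈0) (zeroʳ (x ⁻¹))))

  x⁻¹-nonneg : ∀ {x} → 0# ≤ x → ¬ (x ≈ 0#) → 0# ≤ x ⁻¹
  x⁻¹-nonneg {x} 0≤x x≉0 with total 0# (x ⁻¹)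
  ... | inj₁ 0≤x⁻¹ = 0≤x⁻¹
  ... | inj₂ x⁻¹≤0 =
    contradiction (≤-respˡ-≈ (≈-sym (⁻¹-inverse x x≉0)) (≤-respʳ-≈ (*-monoˡ-≤ 0≤x x⁻¹≤0) (zeroʳ x))) 1≰0

  private
    ∑ = sumK K
    ∏ = prodK K

  sumK-cong : ∀ m {f g : Fin m → Carrier} → (∀ i → f i ≈ g i) → ∑ m f ≈ ∑ m g
  sumK-cong zero    f≈g = ≈-refl
  sumK-cong (suc m) {f} {g} f≈g = +-cong (f≈g zero) (sumK-cong m {f ∘ suc} {g ∘ suc} (f≈g ∘ suc))

  sumK-mono-≤ : ∀ m {f g : Fin m → Carrier} → (∀ i → f i ≤ g i) → ∑ m f ≤ ∑ m g
  sumK-mono-≤ zero    f≤g = ≤-refl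
  sumK-mono-≤ (suc m) {f} {g} f≤g = +-mono-≤ (f≤g zero) (sumK-mono-≤ m {f ∘ suc} {g ∘ suc} (f≤g ∘ suc))

  sumK-zero : ∀ m {f : Fin m → Carrier} → (∀ i → f i ≈ 0#) → ∑ m f ≈ 0#
  sumK-zero zero    f≈0 = ≈-refl
  sumK-zero (suc m) {f} f≈0 = ≈-trans (+-cong (f≈0 zero) (sumK-zero m {f ∘ suc} (f≈0 ∘ suc))) (+-identityʳ 0#)

  sumK-nonneg : ∀ m {f : Fin m → Carrier} → (∀ i → 0# ≤ f i) → 0# ≤ ∑ m f
  sumK-nonneg zero    0≤f = ≤-refl
  sumK-nonneg (suc m) {f} 0≤f =
    ≤-respˡ-≈ (≈-sym (+-identityʳ 0#)) (+-mono-≤ (0≤f zero) (sumK-nonneg m {f ∘ suc} (0≤f ∘ suc)))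

  sumK-single : ∀ m {f : Fin m → Carrier} j → (∀ i → i ≢ j → f i ≈ 0#) → ∑ m f ≈ f j
  sumK-single (suc m) {f} zero    f≈0 =
    ≈-trans (+-congˡ (sumK-zero m {f ∘ suc} (λ i → f≈0 (suc i) (λ ())))) (+-identityʳ _)
  sumK-single (suc m) {f} (suc j) f≈0 =
    ≈-trans (+-congʳ (f≈0 zero (λ ())))
            (≈-trans (+-identityˡ _) (sumK-single m {f ∘ suc} j (λ i i≢j → f≈0 (suc i) (i≢j ∘ suc-injective))))

  term≤sumK : ∀ m {f : Fin m → Carrier} → (∀ i → 0# ≤ f i) → ∀ j → f j ≤ ∑ m f
  term≤sumK (suc m) {f} 0≤f zero =
    ≤-respˡ-≈ (≈-sym (+-identityʳ _)) (+-mono-≤ ≤-refl (sumK-nonneg m {f ∘ suc} (0≤f ∘ suc)))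
  term≤sumK (suc m) {f} 0≤f (suc j) =
    ≤-respˡ-≈ (≈-sym (+-identityˡ _)) (+-mono-≤ (0≤f zero) (term≤sumK m {f ∘ suc} (0≤f ∘ suc) j))

  sumK-+ : ∀ m (f g : Fin m → Carrier) → ∑ m (λ i → f i + g i) ≈ ∑ m f + ∑ m g
  sumK-+ zero    f g = ≈-sym (+-identityʳ 0#)
  sumK-+ (suc m) f g = ≈-trans (+-congˡ (sumK-+ m (f ∘ suc) (g ∘ suc))) (interchange _ _ _ _)

  *-distribˡ-sumK : ∀ m x (f : Fin m → Carrier) → x * ∑ m f ≈ ∑ m (λ i → x * f i)
  *-distribˡ-sumK zero    x f = zeroʳ x
  *-distribˡ-sumK (suc m) x f = ≈-trans (distribˡ x _ _) (+-congˡ (*-distribˡ-sumK m x (f ∘ suc)))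

  sumK-comm : ∀ m m′ (f : Fin m → Fin m′ → Carrier) →
              ∑ m (λ i → ∑ m′ (f i)) ≈ ∑ m′ (λ j → ∑ m (λ i → f i j))
  sumK-comm zero    m′ f = ≈-sym (sumK-zero m′ (λ _ → ≈-refl))
  sumK-comm (suc m) m′ f =
    ≈-trans (+-congˡ (sumK-comm m m′ (f ∘ suc))) (≈-sym (sumK-+ m′ (f zero) _))

  prodK-cong : ∀ m {f g : Fin m → Carrier} → (∀ i → f i ≈ g i) → ∏ m f ≈ ∏ m g
  prodK-cong zero    f≈g = ≈-refl
  prodK-cong (suc m) {f} {g} f≈g = *-cong (f≈g zero) (prodK-cong m {f ∘ suc} {g ∘ suc} (f≈g ∘ suc))

  prodK-one : ∀ m {f : Fin m → Carrier} → (∀ i → f i ≈ 1#) → ∏ m f ≈ 1#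
  prodK-one zero    f≈1 = ≈-refl
  prodK-one (suc m) {f} f≈1 = ≈-trans (*-cong (f≈1 zero) (prodK-one m {f ∘ suc} (f≈1 ∘ suc))) (*-identityˡ 1#)

  prodK-extract : ∀ m {f g : Fin m → Carrier} j → g j ≈ 1# → (∀ i → i ≢ j → f i ≈ g i) →
                  ∏ m f ≈ f j * ∏ m g
  prodK-extract (suc m) {f} {g} zero g0≈1 f≈g =
    *-congˡ (≈-trans (prodK-cong m {f ∘ suc} {g ∘ suc} (λ i → f≈g (suc i) (λ ())))
                     (≈-trans (≈-sym (*-identityˡ _)) (*-congʳ (≈-sym g0≈1))))
  prodK-extract (suc m) {f} {g} (suc j) gj≈1 f≈g = begin
    f zero * ∏ m (f ∘ suc)               ≈⟨ *-cong (f≈g zero (λ ())) rest ⟩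
    g zero * (f (suc j) * ∏ m (g ∘ suc)) ≈⟨ x∙yz≈y∙xz (g zero) (f (suc j)) _ ⟩
    f (suc j) * (g zero * ∏ m (g ∘ suc)) ∎
    where
    rest = prodK-extract m {f ∘ suc} {g ∘ suc} j gj≈1 (λ i i≢j → f≈g (suc i) (i≢j ∘ suc-injective))
    open CommutativeSemigroupProperties *-commutativeSemigroup using (x∙yz≈y∙xz)

sumℕ-cong : ∀ m {f g : Fin m → ℕ} → (∀ i → f i ≡ g i) → sumℕ m f ≡ sumℕ m g
sumℕ-cong zero    f≡g = refl
sumℕ-cong (suc m) f≡g = cong₂ ℕ._+_ (f≡g zero) (sumℕ-cong m (f≡g ∘ suc))

sumℕ-zero : ∀ m {f : Fin m → ℕ} → (∀ i → f i ≡ 0) → sumℕ m f ≡ 0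
sumℕ-zero zero    _   = refl
sumℕ-zero (suc m) f≡0 = cong₂ ℕ._+_ (f≡0 zero) (sumℕ-zero m (f≡0 ∘ suc))

sumℕ-single : ∀ m {f : Fin m → ℕ} j → (∀ i → i ≢ j → f i ≡ 0) → sumℕ m f ≡ f j
sumℕ-single (suc m) {f} zero    f≡0 =
  trans (cong (f zero ℕ.+_) (sumℕ-zero m (λ i → f≡0 (suc i) (λ ())))) (ℕP.+-identityʳ _)
sumℕ-single (suc m) {f} (suc j) f≡0 =
  cong₂ ℕ._+_ (f≡0 zero (λ ())) (sumℕ-single m j (λ i i≢j → f≡0 (suc i) (i≢j ∘ suc-injective)))

-- Walks, paths and forests

module _ (G : Graph) where

  private
    V  = Fin (n G)
    Ed = Fin (k G)
    open DecMembership (_≟_ {n G}) using () renaming (_∈?_ to _∈ₗ?_)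

  private variable
    E E′ : Subset (k G)

  opposite : Ed → V → V
  opposite e a = if does (a ≟ proj₁ (ends G e)) then proj₂ (ends G e) else proj₁ (ends G e)

  joins-sym : ∀ {e a b} → Joins G e a b → Joins G e b a
  joins-sym (inj₁ e≡ab) = inj₂ e≡ab
  joins-sym (inj₂ e≡ba) = inj₁ e≡ba

  joins-unique : ∀ {e a b c d} → Joins G e a b → Joins G e c d → (a ≡ c × b ≡ d) ⊎ (a ≡ d × b ≡ c)
  joins-unique (inj₁ refl) (inj₁ refl) = inj₁ (refl , refl)
  joins-unique (inj₁ refl) (inj₂ refl) = inj₂ (refl , refl)
  joins-unique (inj₂ refl) (inj₁ refl) = inj₂ (refl , refl)
  joins-unique (inj₂ refl) (inj₂ refl) = inj₁ (refl , refl)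

  joins⇒≡opposite : ∀ {e a b} → Joins G e a b → b ≡ opposite e a
  joins⇒≡opposite {e} {a} j with a ≟ proj₁ (ends G e) | j
  ... | yes refl | inj₁ refl = refl
  ... | yes refl | inj₂ e≡ba = trans (sym (cong proj₁ e≡ba)) (sym (cong proj₂ e≡ba))
  ... | no a≢e₁  | inj₁ refl = contradiction refl a≢e₁
  ... | no _     | inj₂ refl = refl

  incident⇒joins : ∀ {e a} → incident G a e ≡ true → Joins G e a (opposite e a)
  incident⇒joins {e} {a} inc with a ≟ proj₁ (ends G e) | a ≟ proj₂ (ends G e) | inc
  ... | yes refl | _        | _ = inj₁ refl
  ... | no _     | yes refl | _ = inj₂ refl

  joins⇒incident : ∀ {e a b} → Joins G e a b → incident G a e ≡ true
  joins⇒incident {e} {a} j with a ≟ proj₁ (ends G e) | a ≟ proj₂ (ends G e) | j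
  ... | yes _   | _       | _         = refl
  ... | no _    | yes _   | _         = refl
  ... | no a≢e₁ | no _    | inj₁ refl = contradiction refl a≢e₁
  ... | no _    | no a≢e₂ | inj₂ refl = contradiction refl a≢e₂

  adj-sym : ∀ {a b} → AdjIn G E a b → AdjIn G E b a
  adj-sym (e , e∈E , j) = e , e∈E , joins-sym j

  reverse : ∀ {a b} → Connected G E a b → Connected G E b a
  reverse = Star.reverse adj-sym

  vertices : ∀ {a b} → Connected G E a b → List V
  vertices {a = a} ε       = a ∷ []
  vertices {a = a} (_ ◅ p) = a ∷ vertices p

  IsPath : ∀ {a b} → Connected G E a b → Set
  IsPath p = Unique (vertices p)

  first∈vertices : ∀ {a b} (p : Connected G E a b) → a ∈ₗ vertices p
  first∈vertices ε       = here refl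
  first∈vertices (_ ◅ _) = here refl

  last∈vertices : ∀ {a b} (p : Connected G E a b) → b ∈ₗ vertices p
  last∈vertices ε       = here refl
  last∈vertices (_ ◅ p) = there (last∈vertices p)

  dropUntil : ∀ {a b c} (p : Connected G E a b) → c ∈ₗ vertices p → Connected G E c b
  dropUntil ε       (here refl) = ε
  dropUntil (s ◅ p) (here refl) = s ◅ p
  dropUntil (s ◅ p) (there c∈p) = dropUntil p c∈p

  dropUntil-isPath : ∀ {a b c} (p : Connected G E a b) (c∈p : c ∈ₗ vertices p) →
                     IsPath p → IsPath (dropUntil p c∈p)
  dropUntil-isPath ε       (here refl) p-path       = p-path
  dropUntil-isPath (s ◅ p) (here refl) p-path       = p-path
  dropUntil-isPath (s ◅ p) (there c∈p) (_ ∷ p-path) = dropUntil-isPath p c∈p p-path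

  takeUntil : ∀ {a b c} (p : Connected G E a b) → c ∈ₗ vertices p → Connected G E a c
  takeUntil ε       (here refl) = ε
  takeUntil (s ◅ p) (here refl) = ε
  takeUntil (s ◅ p) (there c∈p) = s ◅ takeUntil p c∈p

  toPath : ∀ {a b} → Connected G E a b → Σ (Connected G E a b) IsPath
  toPath ε = ε , [] ∷ []
  toPath {a = a} (s ◅ p) with toPath p
  ... | q , q-path with a ∈ₗ? vertices q
  ...   | yes a∈q = dropUntil q a∈q , dropUntil-isPath q a∈q q-path
  ...   | no  a∉q = s ◅ q , ¬Any⇒All¬ _ a∉q ∷ q-path

  avoiding : ∀ {f a z b c} → Joins G f a z → (p : Connected G E b c) → a ∉ₗ vertices p →
             Connected G (E - f) b c
  avoiding jf ε a∉p = ε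
  avoiding jf ((g , g∈E , jg) ◅ p) a∉p =
    (g , x∈p∧x≢y⇒x∈p-y g∈E g≢f , jg) ◅ avoiding jf p (a∉p ∘ there)
    where
    g≢f : _ ≢ _
    g≢f refl with joins-unique jf jg
    ... | inj₁ (refl , _) = a∉p (here refl)
    ... | inj₂ (refl , _) = a∉p (there (first∈vertices p))

  vertices-avoiding : ∀ {f a z b c} (jf : Joins G f a z) (p : Connected G E b c) (a∉p : a ∉ₗ vertices p) →
                      vertices (avoiding jf p a∉p) ≡ vertices p
  vertices-avoiding jf ε       a∉p = refl
  vertices-avoiding jf (_ ◅ p) a∉p = cong (_ ∷_) (vertices-avoiding jf p (a∉p ∘ there))

  length : ∀ {a b} → Connected G E a b → ℕ
  length ε       = 0
  length (_ ◅ p) = suc (length p)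

  vertexAt : ∀ {a b} (p : Connected G E a b) → Fin (suc (length p)) → V
  vertexAt {a = a} ε       zero    = a
  vertexAt {a = a} (_ ◅ p) zero    = a
  vertexAt         (_ ◅ p) (suc i) = vertexAt p i

  edgeAt : ∀ {a b} (p : Connected G E a b) → Fin (length p) → Ed
  edgeAt ((e , _) ◅ p) zero    = e
  edgeAt (_ ◅ p)       (suc i) = edgeAt p i

  vertexAt-first : ∀ {a b} (p : Connected G E a b) → vertexAt p zero ≡ a
  vertexAt-first ε       = refl
  vertexAt-first (_ ◅ p) = refl

  vertexAt-last : ∀ {a b} (p : Connected G E a b) → vertexAt p (fromℕ (length p)) ≡ b
  vertexAt-last ε       = refl
  vertexAt-last (_ ◅ p) = vertexAt-last p

  vertexAt∈vertices : ∀ {a b} (p : Connected G E a b) i → vertexAt p i ∈ₗ vertices p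
  vertexAt∈vertices ε       zero    = here refl
  vertexAt∈vertices (_ ◅ p) zero    = here refl
  vertexAt∈vertices (_ ◅ p) (suc i) = there (vertexAt∈vertices p i)

  vertexAt-injective : ∀ {a b} (p : Connected G E a b) → IsPath p →
                       ∀ {i j} → vertexAt p i ≡ vertexAt p j → i ≡ j
  vertexAt-injective ε       _            {zero}  {zero}  _  = refl
  vertexAt-injective (_ ◅ p) _            {zero}  {zero}  _  = refl
  vertexAt-injective (_ ◅ p) (a∉p ∷ _)    {zero}  {suc j} eq =
    contradiction eq (All.lookup a∉p (vertexAt∈vertices p j))
  vertexAt-injective (_ ◅ p) (a∉p ∷ _)    {suc i} {zero}  eq =
    contradiction (sym eq) (All.lookup a∉p (vertexAt∈vertices p i))
  vertexAt-injective (_ ◅ p) (_ ∷ p-path) {suc i} {suc j} eq = cong suc (vertexAt-injective p p-path eq)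

  edgeAt∈E : ∀ {a b} (p : Connected G E a b) i → edgeAt p i ∈ E
  edgeAt∈E ((_ , e∈E , _) ◅ p) zero    = e∈E
  edgeAt∈E (_ ◅ p)             (suc i) = edgeAt∈E p i

  edgeAt-joins : ∀ {a b} (p : Connected G E a b) i →
                 Joins G (edgeAt p i) (vertexAt p (inject₁ i)) (vertexAt p (suc i))
  edgeAt-joins ((_ , _ , j) ◅ p) zero    = subst (Joins G _ _) (sym (vertexAt-first p)) j
  edgeAt-joins (_ ◅ p)           (suc i) = edgeAt-joins p i

  -- a repeated edge would be traversed in opposite directions, forcing i = j + 1 and i + 1 = j
  edgeAt-injective : ∀ {a b} (p : Connected G E a b) → IsPath p →
                     ∀ {i j} → edgeAt p i ≡ edgeAt p j → i ≡ j
  edgeAt-injective p p-path {i} {j} eq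
    with joins-unique (edgeAt-joins p i) (subst (λ e → Joins G e _ _) (sym eq) (edgeAt-joins p j))
  ... | inj₁ (i≡j , _) = inject₁-injective (vertexAt-injective p p-path i≡j)
  ... | inj₂ (i≡1+j , 1+i≡j) =
    contradiction (sym (trans (sym (cong suc i≈1+j)) 1+i≈j)) (ℕP.m≢1+n+m (toℕ j) {1})
    where
    i≈1+j : toℕ i ≡ suc (toℕ j)
    i≈1+j = trans (sym (toℕ-inject₁ i)) (cong toℕ (vertexAt-injective p p-path i≡1+j))
    1+i≈j : suc (toℕ i) ≡ toℕ j
    1+i≈j = trans (cong toℕ (vertexAt-injective p p-path 1+i≡j)) (toℕ-inject₁ j)

  path-length< : ∀ {a b} (p : Connected G E a b) → IsPath p → length p ℕ.< n G
  path-length< p p-path = injective⇒≤ (vertexAt-injective p p-path)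

  Connected-mono : E ⊆ E′ → ∀ {a b} → Connected G E a b → Connected G E′ a b
  Connected-mono E⊆E′ = Star.map (λ (e , e∈E , j) → e , E⊆E′ e∈E , j)

  Cycle-mono : E ⊆ E′ → Cycle G E → Cycle G E′
  Cycle-mono E⊆E′ C = record
    { l = l ; l≥1 = l≥1 ; es = es ; vs = vs ; es-inj = es-inj ; vs-inj = vs-inj
    ; closed = closed ; es∈E = λ i → E⊆E′ (es∈E i) ; es-joins = es-joins }
    where open Cycle C

  closeCycle : ∀ {f a b} (p : Connected G (E - f) a b) → IsPath p → f ∈ E → Joins G f b a → Cycle G E
  closeCycle {E} {f} {a} {b} p p-path f∈E jf = record
    { l        = suc (length p)
    ; l≥1      = s≤s z≤n
    ; es       = es
    ; vs       = vs
    ; es-inj   = es-inj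
    ; vs-inj   = vs-inj
    ; closed   = vertexAt-last p
    ; es∈E     = es∈E
    ; es-joins = es-joins
    }
    where
    es : Fin (suc (length p)) → Fin (k G)
    es zero    = f
    es (suc i) = edgeAt p i

    vs : Fin (suc (suc (length p))) → Fin (n G)
    vs zero    = b
    vs (suc i) = vertexAt p i

    edgeAt≢f : ∀ i → edgeAt p i ≢ f
    edgeAt≢f i = x∈p-y⇒x≢y (edgeAt∈E p i)

    es-inj : ∀ {i j} → es i ≡ es j → i ≡ j
    es-inj {zero}  {zero}  _  = refl
    es-inj {zero}  {suc j} eq = contradiction (sym eq) (edgeAt≢f j)
    es-inj {suc i} {zero}  eq = contradiction eq (edgeAt≢f i)
    es-inj {suc i} {suc j} eq = cong suc (edgeAt-injective p p-path eq)

    b≢inner : ∀ {i} → b ≢ vertexAt p (inject₁ i)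
    b≢inner eq = fromℕ≢inject₁ (vertexAt-injective p p-path (trans (vertexAt-last p) eq))

    vs-inj : ∀ {i j} → vs (inject₁ i) ≡ vs (inject₁ j) → i ≡ j
    vs-inj {zero}  {zero}  _  = refl
    vs-inj {zero}  {suc j} eq = contradiction eq b≢inner
    vs-inj {suc i} {zero}  eq = contradiction (sym eq) b≢inner
    vs-inj {suc i} {suc j} eq = cong suc (inject₁-injective (vertexAt-injective p p-path eq))

    es∈E : ∀ i → es i ∈ E
    es∈E zero    = f∈E
    es∈E (suc i) = x∈p-y⇒x∈p (edgeAt∈E p i)

    es-joins : ∀ i → Joins G (es i) (vs (inject₁ i)) (vs (suc i))
    es-joins zero    = subst (Joins G f b) (sym (vertexAt-first p)) jf
    es-joins (suc i) = edgeAt-joins p i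

  acyclic⇒bridge : ∀ {f a b} → ¬ Cycle G E → f ∈ E → Joins G f a b → ¬ Connected G (E - f) a b
  acyclic⇒bridge acyclic f∈E jf p =
    acyclic (closeCycle (proj₁ (toPath p)) (proj₂ (toPath p)) f∈E (joins-sym jf))

  degE-remove : ∀ (E : Subset (k G)) {e z} → incident G z e ≡ false → degE G (E - e) z ≡ degE G E z
  degE-remove E {e} {z} z∉e = sumℕ-cong (k G) term
    where
    term : ∀ g → (if incident G z g ∧ lookup (E - e) g then 1 else 0)
               ≡ (if incident G z g ∧ lookup E g then 1 else 0)
    term g with g ≟ e
    ... | yes refl rewrite z∉e = refl
    ... | no  g≢e  rewrite p-x[y]≡p[y] E g≢e = refl

  second-edge : ∀ {E : Subset (k G)} {a} e → ¬ (degE G E a ℕ.≤ 1) →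
                ∃[ f ] (f ≢ e × f ∈ E × incident G a f ≡ true)
  second-edge {E} {a} e deg≰1
    with any? (λ f → ¬? (f ≟ e) ×-dec T? (incident G a f ∧ lookup E f))
  ... | yes (f , f≢e , inc) = f , f≢e , lookup⇒[]= f E (∧-right inc) , ∧-left inc
    where
    ∧-left : ∀ {b c} → T (b ∧ c) → b ≡ true
    ∧-left {true} _ = refl
    ∧-right : ∀ {b c} → T (b ∧ c) → c ≡ true
    ∧-right {true} {true} _ = refl
  ... | no none = contradiction (subst (ℕ._≤ 1) (sym (sumℕ-single (k G) e off-e)) (indicator≤1 _)) deg≰1
    where
    indicator≤1 : ∀ b → (if b then 1 else 0) ℕ.≤ 1
    indicator≤1 true  = s≤s z≤n
    indicator≤1 false = z≤n
    off-e : ∀ f → f ≢ e → (if incident G a f ∧ lookup E f then 1 else 0) ≡ 0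
    off-e f f≢e with incident G a f ∧ lookup E f in eq
    ... | true  = contradiction (f , f≢e , subst T (sym eq) _) none
    ... | false = refl

  endpoints∈V : ∀ {Vs E} → IsSubgraph G (Vs , E) → ∀ {e a b} → e ∈ E → Joins G e a b → a ∈ Vs × b ∈ Vs
  endpoints∈V sub e∈E (inj₁ refl) = sub _ e∈E
  endpoints∈V sub e∈E (inj₂ refl) = proj₂ (sub _ e∈E) , proj₁ (sub _ e∈E)

  module Member {m X Y Vs E} (F : InFam G m X Y (Vs , E)) where

    isSubgraph : IsSubgraph G (Vs , E)
    isSubgraph = proj₁ (proj₁ F)

    acyclic : ¬ Cycle G E
    acyclic = proj₂ (proj₁ F)

    size : ∣ E ∣ ≡ m
    size = proj₁ (proj₂ F)

    leaf∈X∪Y : ∀ z → Leaves G (Vs , E) z → z ∈ X ∪ Y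
    leaf∈X∪Y = proj₁ (proj₂ (proj₂ F))

    X∪Y⊆V : X ∪ Y ⊆ Vs
    X∪Y⊆V = proj₁ (proj₂ (proj₂ (proj₂ F)))

    root : ∀ v → v ∈ Vs → ∃[ y ] (y ∈ Y × Connected G E v y)
    root v v∈V = proj₁ (proj₂ (proj₂ (proj₂ (proj₂ F))) v v∈V)

    root-unique : ∀ {v y y′} → v ∈ Vs → y ∈ Y → y′ ∈ Y → Connected G E v y → Connected G E v y′ → y ≡ y′
    root-unique v∈V y∈Y y′∈Y = proj₂ (proj₂ (proj₂ (proj₂ (proj₂ F))) _ v∈V) _ _ y∈Y y′∈Y

    nonleaf : ∀ {a} → a ∈ Vs → a ∉ X → a ∉ Y → ¬ (degE G E a ℕ.≤ 1)
    nonleaf a∈V a∉X a∉Y deg≤1 with x∈p∪q⁻ X Y (leaf∈X∪Y _ (a∈V , deg≤1))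
    ... | inj₁ a∈X = a∉X a∈X
    ... | inj₂ a∈Y = a∉Y a∈Y

  module NoFreeLeaves {m X Y Vs E} (F : InFam G m X Y (Vs , E)) (X⊆Y : X ⊆ Y) where
    open Member F

    record PathToRoot (y : V) : Set where
      field
        start   : V
        walk    : Connected G E start y
        isPath  : IsPath walk
        start∈V : start ∈ Vs
        start∉Y : start ∉ Y
    open PathToRoot

    extend : ∀ {y} → y ∈ Y → (P : PathToRoot y) →
             Σ (PathToRoot y) λ P′ → suc (length (walk P)) ≡ length (walk P′)
    extend y∈Y record { walk = ε ; start∉Y = y∉Y } = contradiction y∈Y y∉Y
    extend {y} y∈Y record { start = a ; walk = (e , e∈E , je) ◅ r ; isPath = a∉r ∷ r-path
                          ; start∈V = a∈V ; start∉Y = a∉Y }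
      with second-edge {a = a} e (nonleaf a∈V (a∉Y ∘ X⊆Y) a∉Y)
    ... | f , f≢e , f∈E , a∈f with opposite f a ∈ₗ? vertices ((e , e∈E , je) ◅ r)
    ...   | yes z∈walk = contradiction (takeUntil walk′ z∈walk′) (acyclic⇒bridge acyclic f∈E jf)
      where
      jf = incident⇒joins {f} {a} a∈f
      walk′ : Connected G (E - f) a y
      walk′ = (e , x∈p∧x≢y⇒x∈p-y e∈E (f≢e ∘ sym) , je) ◅ avoiding jf r (All¬⇒¬Any a∉r)
      z∈walk′ : opposite f a ∈ₗ vertices walk′
      z∈walk′ = subst (opposite f a ∈ₗ_) (cong (a ∷_) (sym (vertices-avoiding jf r _))) z∈walk
    ...   | no z∉walk = P′ , refl
      where
      jf = incident⇒joins {f} {a} a∈f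
      walk′ = (f , f∈E , joins-sym jf) ◅ (e , e∈E , je) ◅ r
      z∈V = proj₂ (endpoints∈V isSubgraph f∈E jf)
      z∉Y : opposite f a ∉ Y
      z∉Y z∈Y with root-unique z∈V z∈Y y∈Y ε walk′
      ... | refl = z∉walk (last∈vertices ((e , e∈E , je) ◅ r))
      P′ : PathToRoot y
      P′ = record { start = opposite f a ; walk = walk′
                  ; isPath = ¬Any⇒All¬ _ z∉walk ∷ a∉r ∷ r-path ; start∈V = z∈V ; start∉Y = z∉Y }

    long-path : ∀ {y} → y ∈ Y → PathToRoot y → ∀ N → Σ (PathToRoot y) λ P → N ℕ.≤ length (walk P)
    long-path y∈Y P zero = P , z≤n
    long-path y∈Y P (suc N) with long-path y∈Y P N
    ... | P′ , N≤len with extend y∈Y P′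
    ...   | P″ , len≡ = P″ , subst (suc N ℕ.≤_) len≡ (s≤s N≤len)

    V⊆Y : Vs ⊆ Y
    V⊆Y {v} v∈V with v ∈? Y
    ... | yes v∈Y = v∈Y
    ... | no  v∉Y with root v v∈V
    ...   | y , y∈Y , v⇝y with long-path y∈Y P₀ (n G)
      where
      P₀ = record { start = v ; walk = proj₁ (toPath v⇝y) ; isPath = proj₂ (toPath v⇝y)
                  ; start∈V = v∈V ; start∉Y = v∉Y }
    ...     | P , n≤len = contradiction (ℕP.<-≤-trans (path-length< (walk P) (isPath P)) n≤len) (ℕP.<-irrefl refl)

    no-edges : Empty E
    no-edges (e , e∈E) = loopless G e (root-unique a∈V (V⊆Y a∈V) (V⊆Y b∈V) ε ((e , e∈E , inj₁ refl) ◅ ε))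
      where
      a∈V = proj₁ (isSubgraph e e∈E)
      b∈V = proj₂ (isSubgraph e e∈E)

    V≡Y : Vs ≡ Y
    V≡Y = ⊆-antisym V⊆Y (λ y∈Y → X∪Y⊆V (x∈p∪q⁺ (inj₂ y∈Y)))

    E≡⊥ : E ≡ ⊥
    E≡⊥ = Empty-unique no-edges

  splitAtEdge : ∀ {E f x u a b} → Joins G f x u → Connected G E a b →
                Connected G (E - f) a b ⊎ ∃[ c ] (Connected G (E - f) a c × (c ≡ x ⊎ c ≡ u))
  splitAtEdge jf ε = inj₁ ε
  splitAtEdge {f = f} {a = a} jf ((g , g∈E , jg) ◅ p) with g ≟ f
  ... | yes refl = inj₂ (a , ε , [ inj₁ ∘ proj₁ , inj₂ ∘ proj₁ ]′ (joins-unique jg jf))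
  ... | no  g≢f with splitAtEdge jf p
  ...   | inj₁ p′             = inj₁ ((g , x∈p∧x≢y⇒x∈p-y g∈E g≢f , jg) ◅ p′)
  ...   | inj₂ (c , p′ , c∈f) = inj₂ (c , (g , x∈p∧x≢y⇒x∈p-y g∈E g≢f , jg) ◅ p′ , c∈f)

  -- Deleting an edge e = xu of F whose far side u still reaches the root y of x.
  module Remainder {m X Y Vs E} (F : InFam G m X Y (Vs , E)) {x u y e}
                   (x∈V : x ∈ Vs) (y∈Y : y ∈ Y) (e∈E : e ∈ E) (je : Joins G e x u)
                   (r : Connected G (E - e) u y) where
    open Member F

    private
      lift : ∀ {a b} → Connected G (E - e) a b → Connected G E a b
      lift = Connected-mono x∈p-y⇒x∈p

      u∈V : u ∈ Vs
      u∈V = proj₂ (endpoints∈V isSubgraph e∈E je)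

      old∈X′∪Y′ : ∀ {z} → z ∈ X ∪ Y → z ∈ (X ∪ ⁅ u ⁆) ∪ (Y ∪ ⁅ x ⁆)
      old∈X′∪Y′ {z} z∈X∪Y with x∈p∪q⁻ X Y z∈X∪Y
      ... | inj₁ z∈X = x∈p∪q⁺ (inj₁ (x∈p∪q⁺ (inj₁ z∈X)))
      ... | inj₂ z∈Y = x∈p∪q⁺ (inj₂ (x∈p∪q⁺ (inj₁ z∈Y)))

    leaf∈X′∪Y′ : ∀ z → Leaves G (Vs , E - e) z → z ∈ (X ∪ ⁅ u ⁆) ∪ (Y ∪ ⁅ x ⁆)
    leaf∈X′∪Y′ z (z∈V , deg≤1) with z ≟ x | z ≟ u | incident G z e in z∈e
    ... | yes refl | _        | _    = x∈p∪q⁺ (inj₂ x∈p∪⁅x⁆)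
    ... | no _     | yes refl | _    = x∈p∪q⁺ (inj₁ x∈p∪⁅x⁆)
    ... | no z≢x   | no z≢u   | true
      with joins-unique (incident⇒joins {e} {z} z∈e) je
    ...   | inj₁ (z≡x , _) = contradiction z≡x z≢x
    ...   | inj₂ (z≡u , _) = contradiction z≡u z≢u
    leaf∈X′∪Y′ z (z∈V , deg≤1) | no _ | no _ | false =
      old∈X′∪Y′ (leaf∈X∪Y z (z∈V , subst (ℕ._≤ 1) (degE-remove E {e} {z} z∈e) deg≤1))

    X′∪Y′⊆V : (X ∪ ⁅ u ⁆) ∪ (Y ∪ ⁅ x ⁆) ⊆ Vs
    X′∪Y′⊆V {z} z∈ with x∈p∪q⁻ (X ∪ ⁅ u ⁆) (Y ∪ ⁅ x ⁆) z∈
    ... | inj₁ z∈X′ with y∈p∪⁅x⁆⁻ z∈X′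
    ...   | inj₁ refl = u∈V
    ...   | inj₂ z∈X  = X∪Y⊆V (x∈p∪q⁺ (inj₁ z∈X))
    X′∪Y′⊆V {z} z∈ | inj₂ z∈Y′ with y∈p∪⁅x⁆⁻ z∈Y′
    ...   | inj₁ refl = x∈V
    ...   | inj₂ z∈Y  = X∪Y⊆V (x∈p∪q⁺ (inj₂ z∈Y))

    root′ : ∀ {v} → v ∈ Vs → ∃[ y′ ] (y′ ∈ Y ∪ ⁅ x ⁆ × Connected G (E - e) v y′)
    root′ v∈V with root _ v∈V
    ... | y₀ , y₀∈Y , v⇝y₀ with splitAtEdge je v⇝y₀
    ...   | inj₁ v⇝y₀′                  = y₀ , x∈p∪q⁺ (inj₁ y₀∈Y) , v⇝y₀′
    ...   | inj₂ (_ , v⇝x , inj₁ refl) = x , x∈p∪⁅x⁆ , v⇝x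
    ...   | inj₂ (_ , v⇝u , inj₂ refl) = y , x∈p∪q⁺ (inj₁ y∈Y) , v⇝u ◅◅ r

    -- x ⇝ y₂ without e forces y₂ = y, and then r closes a cycle through e
    x-has-no-old-root : ∀ {y₂} → y₂ ∈ Y → ¬ Connected G (E - e) x y₂
    x-has-no-old-root y₂∈Y x⇝y₂ with root-unique x∈V y∈Y y₂∈Y ((e , e∈E , je) ◅ lift r) (lift x⇝y₂)
    ... | refl = acyclic⇒bridge acyclic e∈E je (x⇝y₂ ◅◅ reverse r)

    root′-unique : ∀ {v y₁ y₂} → v ∈ Vs → y₁ ∈ Y ∪ ⁅ x ⁆ → y₂ ∈ Y ∪ ⁅ x ⁆ →
                   Connected G (E - e) v y₁ → Connected G (E - e) v y₂ → y₁ ≡ y₂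
    root′-unique v∈V y₁∈ y₂∈ v⇝y₁ v⇝y₂ with y∈p∪⁅x⁆⁻ y₁∈ | y∈p∪⁅x⁆⁻ y₂∈
    ... | inj₁ refl | inj₁ refl = refl
    ... | inj₂ y₁∈Y | inj₂ y₂∈Y = root-unique v∈V y₁∈Y y₂∈Y (lift v⇝y₁) (lift v⇝y₂)
    ... | inj₁ refl | inj₂ y₂∈Y = contradiction (reverse v⇝y₁ ◅◅ v⇝y₂) (x-has-no-old-root y₂∈Y)
    ... | inj₂ y₁∈Y | inj₁ refl = contradiction (reverse v⇝y₂ ◅◅ v⇝y₁) (x-has-no-old-root y₁∈Y)

    remainder : InFam G ∣ E - e ∣ (X ∪ ⁅ u ⁆) (Y ∪ ⁅ x ⁆) (Vs , E - e)
    remainder =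
      ((λ g g∈E′ → isSubgraph g (x∈p-y⇒x∈p g∈E′)) , acyclic ∘ Cycle-mono x∈p-y⇒x∈p) ,
      refl , leaf∈X′∪Y′ , X′∪Y′⊆V ,
      λ v v∈V → root′ v∈V , λ _ _ → root′-unique v∈V

  record FirstEdge (X Y Vs : Subset (n G)) (E : Subset (k G)) (x : V) : Set where
    field
      edge      : Ed
      edge∈E    : edge ∈ E
      x∈edge    : incident G x edge ≡ true
      remainder : InFam G ∣ E - edge ∣ (X ∪ ⁅ opposite edge x ⁆) (Y ∪ ⁅ x ⁆) (Vs , E - edge)

  -- edge is the first edge on the path from x to its root
  firstEdge : ∀ {m X Y Vs E x} → InFam G m X Y (Vs , E) → x ∈ Vs → x ∉ Y → FirstEdge X Y Vs E x
  firstEdge {X = X} {Y} {Vs} {E} {x} F x∈V x∉Y with Member.root F _ x∈V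
  ... | y , y∈Y , x⇝y with toPath x⇝y
  ...   | ε , _ = contradiction y∈Y x∉Y
  ...   | (e , e∈E , je) ◅ r , x∉r ∷ _ = record
    { edge      = e
    ; edge∈E    = e∈E
    ; x∈edge    = joins⇒incident je
    ; remainder = subst (λ u → InFam G ∣ E - e ∣ (X ∪ ⁅ u ⁆) (Y ∪ ⁅ x ⁆) (Vs , E - e)) (joins⇒≡opposite je)
                        (Remainder.remainder F x∈V y∈Y e∈E je (avoiding je r (All¬⇒¬Any x∉r)))
    }

-- The weighted series

module Counting {c ℓ} (K : OrderedField c ℓ) (G : Graph) (w : Fin (k G) → OrderedField.Carrier K)
                (w≥0 : ∀ e → OrderedField._≤_ K (OrderedField.0# K) (w e))
                (Δ : OrderedField.Carrier K) (Δ-max : IsMaxDeg K G w Δ) where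

  open OrderedField K hiding (zero; _-_; -_)
    renaming (refl to ≈-refl; sym to ≈-sym; trans to ≈-trans)
  open OrderedFieldProperties K

  private
    ∑ = sumK K
    Ed = Fin (k G)

  weight-remove : ∀ {Vs E e} → e ∈ E → weight K G w (Vs , E) ≈ w e * weight K G w (Vs , E - e)
  weight-remove {Vs} {E} {e} e∈E = ≈-trans (prodK-extract (k G) e at-e≈1 off-e) (*-congʳ at-e≈w)
    where
    at-e≈1 : (if lookup (E - e) e then w e else 1#) ≈ 1#
    at-e≈1 rewrite p-x[x]≡outside E e = ≈-refl
    at-e≈w : (if lookup E e then w e else 1#) ≈ w e
    at-e≈w rewrite []=⇒lookup e∈E = ≈-refl
    off-e : ∀ g → g ≢ e → (if lookup E g then w g else 1#) ≈ (if lookup (E - e) g then w g else 1#)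
    off-e g g≢e rewrite p-x[y]≡p[y] E g≢e = ≈-refl

  weight-⊥ : ∀ {Vs} → weight K G w (Vs , ⊥) ≈ 1#
  weight-⊥ = prodK-one (k G) λ g → reflexive (cong (if_then w g else 1#) (lookup-replicate g false))

  private
    0≤degW-term : ∀ a g → 0# ≤ (if incident G a g then w g else 0#)
    0≤degW-term a g with incident G a g
    ... | true  = w≥0 g
    ... | false = ≤-refl

  0≤degW : ∀ a → 0# ≤ degW K G w a
  0≤degW a = sumK-nonneg (k G) (0≤degW-term a)

  w≤Δ : ∀ g → w g ≤ Δ
  w≤Δ g = ≤-trans (≤-respˡ-≈ (≈-sym at-g) (term≤sumK (k G) (0≤degW-term a) g)) (proj₁ Δ-max a)
    where
    a = proj₁ (ends G g)
    at-g : (if incident G a g then w g else 0#) ≈ w g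
    at-g rewrite joins⇒incident G {g} {a} (inj₁ refl) = ≈-refl

  0≤Δ : ∀ (x : Fin (n G)) → 0# ≤ Δ
  0≤Δ x = ≤-trans (0≤degW x) (proj₁ Δ-max x)

  -- Δ ≈ 0 forces every weight to vanish; otherwise Δ⁻¹ ≥ 0 and Δ⁻¹ * degW x ≤ Δ⁻¹ * Δ ≈ 1.
  Δ⁻¹-weighted-sum≤1 : ∀ x (t : Ed → Carrier) → (∀ g → t g ≤ 1#) →
                       (∀ g → incident G x g ≡ false → t g ≈ 0#) →
                       ∑ (k G) (λ g → (Δ ⁻¹ * w g) * t g) ≤ 1#
  Δ⁻¹-weighted-sum≤1 x t t≤1 t≈0 with total (∑ (k G) (λ g → (Δ ⁻¹ * w g) * t g)) 1#
  ... | inj₁ sum≤1 = sum≤1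
  ... | inj₂ 1≤sum = begin
    ∑ (k G) (λ g → (Δ ⁻¹ * w g) * t g)                           ≤⟨ sumK-mono-≤ (k G) term≤ ⟩
    ∑ (k G) (λ g → Δ ⁻¹ * (if incident G x g then w g else 0#))  ≈⟨ *-distribˡ-sumK (k G) (Δ ⁻¹) _ ⟨
    Δ ⁻¹ * degW K G w x                                          ≤⟨ *-monoˡ-≤ 0≤Δ⁻¹ (proj₁ Δ-max x) ⟩
    Δ ⁻¹ * Δ                                                     ≤⟨ x⁻¹*x≤1 Δ ⟩
    1#                                                           ∎
    where
    open import Relation.Binary.Reasoning.PartialOrder poset

    Δ≉0 : ¬ (Δ ≈ 0#)
    Δ≉0 Δ≈0 = 1≰0 (≤-respʳ-≈ 1≤sum (sumK-zero (k G) term≈0))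
      where
      term≈0 : ∀ g → (Δ ⁻¹ * w g) * t g ≈ 0#
      term≈0 g = ≈-trans (*-congʳ (≈-trans (*-congˡ w≈0) (zeroʳ _))) (zeroˡ _)
        where w≈0 = antisym (≤-respʳ-≈ (w≤Δ g) Δ≈0) (w≥0 g)

    0≤Δ⁻¹ : 0# ≤ Δ ⁻¹
    0≤Δ⁻¹ = x⁻¹-nonneg (0≤Δ x) Δ≉0

    term≤ : ∀ g → (Δ ⁻¹ * w g) * t g ≤ Δ ⁻¹ * (if incident G x g then w g else 0#)
    term≤ g with incident G x g in x∈g
    ... | true  = ≤-respʳ-≈ (*-monoˡ-≤ (*-nonneg 0≤Δ⁻¹ (w≥0 g)) (t≤1 g)) (*-identityʳ _)
    ... | false = ≤-reflexive (≈-trans (*-congˡ (t≈0 g x∈g)) (≈-trans (zeroʳ _) (≈-sym (zeroʳ _))))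

  𝓕 : ℕ → Subset (n G) → Subset (n G) → Set
  𝓕 m X Y = Σ (SubG G) (InFam G m X Y)

  private
    f : List (SubG G) → Carrier
    f = fSum K G w

    ⌊_⌋ : ∀ {m X Y} → List (𝓕 m X Y) → List (SubG G)
    ⌊ L ⌋ = map proj₁ L

  series : ℕ → (ℕ → List (SubG G)) → Carrier
  series N Fs = ∑ N (λ i → powK K (Δ ⁻¹) (toℕ i) * f (Fs (toℕ i)))

  series-cong : ∀ N {Fs Hs} → (∀ m → Fs m ≡ Hs m) → series N Fs ≈ series N Hs
  series-cong N Fs≡Hs = sumK-cong N λ i → *-congˡ (reflexive (cong f (Fs≡Hs (toℕ i))))

  series-suc : ∀ N Fs → series (suc N) Fs ≈ f (Fs 0) + Δ ⁻¹ * series N (λ m → Fs (suc m))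
  series-suc N Fs = +-cong (*-identityˡ _)
    (≈-sym (≈-trans (*-distribˡ-sumK N (Δ ⁻¹) _) (sumK-cong N λ i → ≈-sym (*-assoc _ _ _))))

  series-zero : ∀ N Fs → (∀ m → f (Fs m) ≈ 0#) → series N Fs ≈ 0#
  series-zero N Fs f≈0 = sumK-zero N λ i → ≈-trans (*-congˡ (f≈0 (toℕ i))) (zeroʳ _)

  series-linear : ∀ N Fs (Hs : Ed → ℕ → List (SubG G)) →
                  (∀ m → f (Fs m) ≈ ∑ (k G) (λ g → w g * f (Hs g m))) →
                  series N Fs ≈ ∑ (k G) (λ g → w g * series N (Hs g))
  series-linear N Fs Hs f≈∑ = begin
    ∑ N (λ i → powK K (Δ ⁻¹) (toℕ i) * f (Fs (toℕ i)))
      ≈⟨ sumK-cong N (λ i → ≈-trans (*-congˡ (f≈∑ (toℕ i))) (*-distribˡ-sumK (k G) _ _)) ⟩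
    ∑ N (λ i → ∑ (k G) (λ g → powK K (Δ ⁻¹) (toℕ i) * (w g * f (Hs g (toℕ i)))))
      ≈⟨ sumK-comm N (k G) _ ⟩
    ∑ (k G) (λ g → ∑ N (λ i → powK K (Δ ⁻¹) (toℕ i) * (w g * f (Hs g (toℕ i)))))
      ≈⟨ sumK-cong (k G) (λ g → ≈-trans (sumK-cong N (λ i → x∙yz≈y∙xz _ _ _))
                                        (≈-sym (*-distribˡ-sumK N (w g) _))) ⟩
    ∑ (k G) (λ g → w g * series N (Hs g)) ∎
    where
    open import Relation.Binary.Reasoning.Setoid setoid
    open CommutativeSemigroupProperties *-commutativeSemigroup using (x∙yz≈y∙xz)

  fSum-empty : ∀ {m X Y} → ¬ 𝓕 m X Y → (L : List (𝓕 m X Y)) → f ⌊ L ⌋ ≈ 0#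
  fSum-empty ∄F []      = ≈-refl
  fSum-empty ∄F (F ∷ _) = contradiction F ∄F

  Bound : Subset (n G) → Subset (n G) → Set ℓ
  Bound X Y = ∀ N (Ls : ∀ m → List (𝓕 m X Y)) → (∀ m → Unique ⌊ Ls m ⌋) → series N (λ m → ⌊ Ls m ⌋) ≤ 1#

  module Base {X Y : Subset (n G)} (X⊆Y : X ⊆ Y) where

    forest≡Y,⊥ : ∀ {m} (F : 𝓕 m X Y) → proj₁ F ≡ (Y , ⊥)
    forest≡Y,⊥ (_ , F) = cong₂ _,_ (NoFreeLeaves.V≡Y G F X⊆Y) (NoFreeLeaves.E≡⊥ G F X⊆Y)

    ∄𝓕-suc : ∀ {m} → ¬ 𝓕 (suc m) X Y
    ∄𝓕-suc {m} ((_ , E) , F) = ℕP.0≢1+n (trans (sym (∣⊥∣≡0 (k G)))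
                                              (trans (cong ∣_∣ (sym (NoFreeLeaves.E≡⊥ G F X⊆Y)))
                                                       (Member.size G F)))

    fSum-𝓕₀≤1 : (L : List (𝓕 0 X Y)) → Unique ⌊ L ⌋ → f ⌊ L ⌋ ≤ 1#
    fSum-𝓕₀≤1 []           _                = 0≤1
    fSum-𝓕₀≤1 (F ∷ [])     _                =
      ≤-reflexive (≈-trans (+-identityʳ _) (≈-trans (reflexive (cong (weight K G w) (forest≡Y,⊥ F))) (weight-⊥ {Y})))
    fSum-𝓕₀≤1 (F ∷ F′ ∷ _) ((F≢F′ ∷ _) ∷ _) =
      contradiction (trans (forest≡Y,⊥ F) (sym (forest≡Y,⊥ F′))) F≢F′

    bound : Bound X Y
    bound zero    Ls uniq = 0≤1
    bound (suc N) Ls uniq = ≤-respˡ-≈ series≈f₀ (fSum-𝓕₀≤1 (Ls 0) (uniq 0))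
      where
      series≈f₀ : series (suc N) (λ m → ⌊ Ls m ⌋) ≈ f ⌊ Ls 0 ⌋
      series≈f₀ = begin
        series (suc N) (λ m → ⌊ Ls m ⌋)                      ≈⟨ series-suc N (λ m → ⌊ Ls m ⌋) ⟩
        f ⌊ Ls 0 ⌋ + Δ ⁻¹ * series N (λ m → ⌊ Ls (suc m) ⌋) ≈⟨ +-congˡ (*-congˡ later≈0) ⟩
        f ⌊ Ls 0 ⌋ + Δ ⁻¹ * 0#                               ≈⟨ +-congˡ (zeroʳ _) ⟩
        f ⌊ Ls 0 ⌋ + 0#                                      ≈⟨ +-identityʳ _ ⟩
        f ⌊ Ls 0 ⌋                                           ∎
        where
        open import Relation.Binary.Reasoning.Setoid setoid
        later≈0 = series-zero N (λ m → ⌊ Ls (suc m) ⌋) (λ m → fSum-empty ∄𝓕-suc (Ls (suc m)))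

  module Step {X Y : Subset (n G)} {x} (x∈X : x ∈ X) (x∉Y : x ∉ Y) where

    X′ : Ed → Subset (n G)
    X′ g = X ∪ ⁅ opposite G g x ⁆

    Y′ : Subset (n G)
    Y′ = Y ∪ ⁅ x ⁆

    private
      firstEdgeOf : ∀ {m} (F : 𝓕 m X Y) → FirstEdge G X Y (proj₁ (proj₁ F)) (proj₂ (proj₁ F)) x
      firstEdgeOf (_ , F) = firstEdge G F (Member.X∪Y⊆V G F (x∈p∪q⁺ (inj₁ x∈X))) x∉Y

      edgeOf : ∀ {m} → 𝓕 m X Y → Ed
      edgeOf F = FirstEdge.edge (firstEdgeOf F)

      size-remove : ∀ {m} (F : 𝓕 m X Y) → m ≡ suc ∣ proj₂ (proj₁ F) - edgeOf F ∣
      size-remove F@(_ , F′) =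
        trans (sym (Member.size G F′)) (x∈p⇒∣p∣≡1+∣p-x∣ (FirstEdge.edge∈E (firstEdgeOf F)))

      removed : ∀ {m} → Ed → 𝓕 m X Y → SubG G
      removed g ((Vs , E) , _) = Vs , E - g

      removeFirst : ∀ {m} (F : 𝓕 (suc m) X Y) → 𝓕 m (X′ (edgeOf F)) Y′
      removeFirst F@((Vs , E) , _) = (Vs , E - edgeOf F) ,
        subst (λ m → InFam G m (X′ (edgeOf F)) Y′ (Vs , E - edgeOf F))
                (sym (ℕP.suc-injective (size-remove F))) (FirstEdge.remainder (firstEdgeOf F))

    ∄𝓕₀ : ¬ 𝓕 0 X Y
    ∄𝓕₀ F = ℕP.0≢1+n (size-remove F)

    split : ∀ {m} g → List (𝓕 (suc m) X Y) → List (𝓕 m (X′ g) Y′)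
    split g []      = []
    split g (F ∷ L) with edgeOf F ≟ g
    ... | yes refl = removeFirst F ∷ split g L
    ... | no  _      = split g L

    split-cons : ∀ {m} g (F : 𝓕 (suc m) X Y) L → f ⌊ split g (F ∷ L) ⌋ ≈ f ⌊ split g (F ∷ []) ⌋ + f ⌊ split g L ⌋
    split-cons g F L with edgeOf F ≟ g
    ... | yes refl = +-congʳ (≈-sym (+-identityʳ _))
    ... | no  _      = ≈-sym (+-identityˡ _)

    weight≈∑split : ∀ {m} (F : 𝓕 (suc m) X Y) →
                    weight K G w (proj₁ F) ≈ ∑ (k G) (λ g → w g * f ⌊ split g (F ∷ []) ⌋)
    weight≈∑split F = ≈-sym (≈-trans (sumK-single (k G) (edgeOf F) off-edge) at-edge)
      where
      off-edge : ∀ g → g ≢ edgeOf F → w g * f ⌊ split g (F ∷ []) ⌋ ≈ 0#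
      off-edge g g≢e with edgeOf F ≟ g
      ... | yes e≡g = contradiction (sym e≡g) g≢e
      ... | no  _   = zeroʳ (w g)
      at-edge : w (edgeOf F) * f ⌊ split (edgeOf F) (F ∷ []) ⌋ ≈ weight K G w (proj₁ F)
      at-edge with edgeOf F ≟ edgeOf F
      ... | yes refl =
        ≈-trans (*-congˡ (+-identityʳ _)) (≈-sym (weight-remove {proj₁ (proj₁ F)} (FirstEdge.edge∈E (firstEdgeOf F))))
      ... | no  e≢e    = contradiction refl e≢e

    fSum-split : ∀ {m} (L : List (𝓕 (suc m) X Y)) → f ⌊ L ⌋ ≈ ∑ (k G) (λ g → w g * f ⌊ split g L ⌋)
    fSum-split []      = ≈-sym (sumK-zero (k G) λ g → zeroʳ (w g))
    fSum-split (F ∷ L) = begin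
      weight K G w (proj₁ F) + f ⌊ L ⌋
        ≈⟨ +-cong (weight≈∑split F) (fSum-split L) ⟩
      ∑ (k G) (λ g → w g * f ⌊ split g (F ∷ []) ⌋) + ∑ (k G) (λ g → w g * f ⌊ split g L ⌋)
        ≈⟨ sumK-+ (k G) _ _ ⟨
      ∑ (k G) (λ g → w g * f ⌊ split g (F ∷ []) ⌋ + w g * f ⌊ split g L ⌋)
        ≈⟨ sumK-cong (k G) (λ g → ≈-trans (≈-sym (distribˡ (w g) _ _)) (*-congˡ (≈-sym (split-cons g F L)))) ⟩
      ∑ (k G) (λ g → w g * f ⌊ split g (F ∷ L) ⌋) ∎
      where open import Relation.Binary.Reasoning.Setoid setoid

    split-incident : ∀ {m} g (L : List (𝓕 (suc m) X Y)) → incident G x g ≡ false → split g L ≡ []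
    split-incident g []      x∉g = refl
    split-incident g (F ∷ L) x∉g with edgeOf F ≟ g
    ... | yes refl = contradiction (trans (sym x∉g) (FirstEdge.x∈edge (firstEdgeOf F))) λ ()
    ... | no  _      = split-incident g L x∉g

    split-All : ∀ {m g} {P : SubG G → Set} (L : List (𝓕 (suc m) X Y)) →
                All (λ F → edgeOf F ≡ g → P (removed g F)) L → All P ⌊ split g L ⌋
    split-All []      []         = []
    split-All {g = g} (F ∷ L) (PF ∷ PL) with edgeOf F ≟ g
    ... | yes refl = PF refl ∷ split-All L PL
    ... | no  _      = split-All L PL

    split-unique : ∀ {m} g (L : List (𝓕 (suc m) X Y)) → Unique ⌊ L ⌋ → Unique ⌊ split g L ⌋
    split-unique g []      []             = []
    split-unique {m} g (F ∷ L) (F∉L ∷ L-uniq) with edgeOf F ≟ g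
    ... | no  _      = split-unique g L L-uniq
    ... | yes refl =
      split-All {P = removed (edgeOf F) F ≢_} L (All.map (λ {F′} → removal-injective {F′}) (map⁻ F∉L))
        ∷ split-unique g L L-uniq
      where
      removal-injective : ∀ {F′ : 𝓕 (suc m) X Y} → proj₁ F ≢ proj₁ F′ → edgeOf F′ ≡ edgeOf F →
                          removed (edgeOf F) F ≢ removed (edgeOf F) F′
      removal-injective {F′} F≢F′ e′≡e eq = F≢F′ (cong₂ _,_ (cong proj₁ eq)
        (p-x≡q-x⇒p≡q (FirstEdge.edge∈E (firstEdgeOf F))
                     (subst (_∈ proj₂ (proj₁ F′)) e′≡e (FirstEdge.edge∈E (firstEdgeOf F′)))
                     (cong proj₂ eq)))

    bound : (∀ g → Bound (X′ g) Y′) → Bound X Y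
    bound IH zero    Ls uniq = 0≤1
    bound IH (suc N) Ls uniq = ≤-respˡ-≈ series≈ (Δ⁻¹-weighted-sum≤1 x t t≤1 t≈0)
      where
      Ls′ : ∀ g m → List (𝓕 m (X′ g) Y′)
      Ls′ g m = split g (Ls (suc m))

      t : Ed → Carrier
      t g = series N (λ m → ⌊ Ls′ g m ⌋)

      t≤1 : ∀ g → t g ≤ 1#
      t≤1 g = IH g N (Ls′ g) (λ m → split-unique g (Ls (suc m)) (uniq (suc m)))

      t≈0 : ∀ g → incident G x g ≡ false → t g ≈ 0#
      t≈0 g x∉g = series-zero N (λ m → ⌊ Ls′ g m ⌋) λ m →
        reflexive (cong (λ L → f ⌊ L ⌋) (split-incident g (Ls (suc m)) x∉g))

      series≈ : series (suc N) (λ m → ⌊ Ls m ⌋) ≈ ∑ (k G) (λ g → (Δ ⁻¹ * w g) * t g)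
      series≈ = begin
        series (suc N) (λ m → ⌊ Ls m ⌋)
          ≈⟨ series-suc N (λ m → ⌊ Ls m ⌋) ⟩
        f ⌊ Ls 0 ⌋ + Δ ⁻¹ * series N (λ m → ⌊ Ls (suc m) ⌋)
          ≈⟨ ≈-trans (+-congʳ (fSum-empty ∄𝓕₀ (Ls 0))) (+-identityˡ _) ⟩
        Δ ⁻¹ * series N (λ m → ⌊ Ls (suc m) ⌋)
          ≈⟨ *-congˡ (series-linear N (λ m → ⌊ Ls (suc m) ⌋) (λ g m → ⌊ Ls′ g m ⌋)
                                    (λ m → fSum-split (Ls (suc m)))) ⟩
        Δ ⁻¹ * ∑ (k G) (λ g → w g * t g)
          ≈⟨ ≈-trans (*-distribˡ-sumK (k G) _ _) (sumK-cong (k G) λ g → ≈-sym (*-assoc _ _ _)) ⟩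
        ∑ (k G) (λ g → (Δ ⁻¹ * w g) * t g) ∎
        where open import Relation.Binary.Reasoning.Setoid setoid

  bound : ∀ d {X Y} → n G ℕ.≤ d ℕ.+ ∣ Y ∣ → Bound X Y
  bound d {X} {Y} n≤d+∣Y∣ with ⊆-or-∉ X Y | d
  ... | inj₁ X⊆Y             | _      = Base.bound X⊆Y
  ... | inj₂ (x , x∈X , x∉Y) | zero   =
    contradiction (ℕP.≤-trans (∣p∣≤n (Y ∪ ⁅ x ⁆)) n≤d+∣Y∣) (ℕP.<⇒≱ (x∉p⇒∣p∣<∣p∪⁅x⁆∣ x∉Y))
  ... | inj₂ (x , x∈X , x∉Y) | suc d′ = Step.bound x∈X x∉Y λ g →
    bound d′ (ℕP.≤-trans n≤d+∣Y∣ (ℕP.≤-trans (ℕP.≤-reflexive (sym (ℕP.+-suc d′ ∣ Y ∣)))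
                                            (ℕP.+-monoʳ-≤ d′ (x∉p⇒∣p∣<∣p∪⁅x⁆∣ x∉Y))))

map-proj₁-toList : ∀ {A : Set} {P : A → Set} {xs : List A} (pxs : All P xs) → map proj₁ (All.toList pxs) ≡ xs
map-proj₁-toList []        = refl
map-proj₁-toList (_ ∷ pxs) = cong (_ ∷_) (map-proj₁-toList pxs)

proposition5p1 : ∀ {c ℓ} (K : OrderedField c ℓ) → let open OrderedField K in
    (G : Graph) (w : Fin (k G) → Carrier) → (∀ e → 0# ≤ w e) →
    (Δ : Carrier) → IsMaxDeg K G w Δ →
    (X Y : Subset (n G)) → Nonempty Y →
    (enum : ℕ → List (SubG G)) →
    (∀ m → Enumerates (InFam G m X Y) (enum m)) →
    -- every partial sum of the series sum over m of Delta^(-m) f_m(X,Y) is at most 1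
    ∀ N → sumK K N (λ m → powK K (Δ ⁻¹) (toℕ m) * fSum K G w (enum (toℕ m))) ≤ 1#
proposition5p1 K G w w≥0 Δ Δ-max X Y _ enum enumerates N =
  ≤-respˡ-≈ (series-cong N (λ m → sym (map-proj₁-toList (sound m))))
            (bound (n G) (ℕP.m≤m+n (n G) _) N members members-unique)
  where
  open OrderedFieldProperties K using (≤-respˡ-≈)
  open Counting K G w w≥0 Δ Δ-max

  sound : ∀ m → All (InFam G m X Y) (enum m)
  sound m = All.tabulate (Enumerates.sound (enumerates m) _)

  members : ∀ m → List (𝓕 m X Y)
  members m = All.toList (sound m)

  members-unique : ∀ m → Unique (map proj₁ (members m))
  members-unique m = subst Unique (sym (map-proj₁-toList (sound m))) (Enumerates.unique (enumerates m))
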